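{- Let $\sigma,\tau$ be types with $\sigma\le\tau$. Then (1) there is a finite hereditary identity $\mathsf{Id}$ such that $\vdash\mathsf{Id}:\sigma\to\tau$; and (2) $\sigma\wedge\tau\approx_{\mathsf s}\sigma$ and $\sigma\vee\tau\approx_{\mathsf s}\tau$.
   Context: Types: $\sigma ::= \varphi \mid \omega \mid \sigma\to\sigma \mid \sigma\wedge\sigma \mid \sigma\vee\sigma$, $\varphi$ ranging over a denumerable set of atomic types, $\omega$ a further constant. Semantic equivalence $\simeq$ is the least congruence with $\varphi\simeq\omega\to\varphi$, $\omega\simeq\omega\to\omega$, $\sigma\simeq\sigma\wedge\omega$, $\sigma\simeq\omega\wedge\sigma$, $\omega\simeq\sigma\vee\omega$, $\omega\simeq\omega\vee\sigma$. Types are assigned to linear $\lambda$-terms (each free or bound variable occurs exactly once); environments are finite maps from variables to types, $\Gamma_1,\Gamma_2$ denotes union with disjoint domains. Rules: (Ax) $x:\sigma\vdash x:\sigma$; ($\simeq$) from $\Gamma\vdash M:\sigma$, $\sigma\simeq\tau$ infer $\Gamma\vdash M:\tau$; ($\to I$) from $\Gamma,x:\sigma\vdash M:\tau$ infer $\Gamma\vdash\lambda x.M:\sigma\to\tau$; ($\to E$) from $\Gamma_1\vdash M:\sigma\to\tau$, $\Gamma_2\vdash N:\sigma$ infer $\Gamma_1,\Gamma_2\vdash MN:\tau$; ($\wedge I$) from $\Gamma\vdash M:\sigma$, $\Gamma\vdash M:\tau$ infer $\Gamma\vdash M:\sigma\wedge\tau$; ($\wedge E$) from $\Gamma\vdash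 M:\sigma\wedge\tau$ infer $\Gamma\vdash M:\sigma$ and $\Gamma\vdash M:\tau$; ($\vee I$) from $\Gamma\vdash M:\sigma$ infer $\Gamma\vdash M:\sigma\vee\tau$ and $\Gamma\vdash M:\tau\vee\sigma$; ($\vee E$) from $\Gamma_1,x:\sigma\wedge\zeta\vdash M:\rho$, $\Gamma_1,x:\tau\wedge\zeta\vdash M:\rho$, $\Gamma_2\vdash N:(\sigma\vee\tau)\wedge\zeta$ infer $\Gamma_1,\Gamma_2\vdash M[N/x]:\rho$. A finite hereditary identity (FHI) is a $\lambda$-term $\beta$-convertible to $\lambda xy_1\ldots y_n.x(\mathsf{Id}_1y_1)\ldots(\mathsf{Id}_ny_n)$ ($n\ge0$) with $\mathsf{Id}_1,\ldots,\mathsf{Id}_n$ FHIs. $\sigma\approx_{\mathsf s}\tau$ (strongly isomorphic) if there is an FHI $\mathsf{Id}$ with $\vdash\mathsf{Id}:\sigma\to\tau$ and $\vdash\mathsf{Id}:\tau\to\sigma$. The normalisation preorder $\le$ is the least preorder on types such that $\sigma\le\omega$, $\sigma\wedge\tau\le\sigma$, $\sigma\wedge\tau\le\tau$, $\sigma\le\sigma\vee\tau$, $\tau\le\sigma\vee\tau$, ($\sigma\le\tau$ and $\sigma\le\rho$ imply $\sigma\le\tau\wedge\rho$), ($\sigma\le\tau$ and $\rho\le\tau$ imply $\sigma\vee\rho\le\tau$), $\varphi\le\sigma\to\varphi$, $\omega\le\sigma\to\omega$, ($\sigma'\le\sigma$ and $\tau\le\tau'$ imply $\sigma\to\tau\le\sigma'\to\tau'$).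 -}

module Defs where

open import Data.Nat using (ℕ; zero; suc; _+_; _∸_; _<ᵇ_; compare; less; equal; greater)
open import Data.Fin using (Fin; toℕ)
open import Data.Bool using (if_then_else_)
open import Data.Maybe using (Maybe; just; nothing)
open import Data.Product using (Σ; _×_; _,_)
open import Data.Sum using (_⊎_)
open import Data.List using (List; []; _∷_; foldl)
import Data.List as List
open import Relation.Binary.PropositionalEquality using (_≡_; _≢_)

infixr 7 _⇒_
infixl 8 _∧_
infixl 8 _∨_

data Ty : Set where
  atom : ℕ → Ty
  ω    : Ty
  _⇒_  : Ty → Ty → Ty
  _∧_  : Ty → Ty → Ty
  _∨_  : Ty → Ty → Ty

infix 4 _≃_
data _≃_ : Ty → Ty → Set where
  ≃-refl  : ∀ {σ} → σ ≃ σ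
  ≃-sym   : ∀ {σ τ} → σ ≃ τ → τ ≃ σ
  ≃-trans : ∀ {σ τ ρ} → σ ≃ τ → τ ≃ ρ → σ ≃ ρ
  ≃-⇒     : ∀ {σ σ' τ τ'} → σ ≃ σ' → τ ≃ τ' → σ ⇒ τ ≃ σ' ⇒ τ'
  ≃-∧     : ∀ {σ σ' τ τ'} → σ ≃ σ' → τ ≃ τ' → σ ∧ τ ≃ σ' ∧ τ'
  ≃-∨     : ∀ {σ σ' τ τ'} → σ ≃ σ' → τ ≃ τ' → σ ∨ τ ≃ σ' ∨ τ'
  ax-atom : ∀ {n} → atom n ≃ ω ⇒ atom n
  ax-ω    : ω ≃ ω ⇒ ω
  ax-∧r   : ∀ {σ} → σ ≃ σ ∧ ω
  ax-∧l   : ∀ {σ} → σ ≃ ω ∧ σ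
  ax-∨r   : ∀ {σ} → ω ≃ σ ∨ ω
  ax-∨l   : ∀ {σ} → ω ≃ ω ∨ σ

infix 4 _≤_
data _≤_ : Ty → Ty → Set where
  ≤-refl  : ∀ {σ} → σ ≤ σ
  ≤-trans : ∀ {σ τ ρ} → σ ≤ τ → τ ≤ ρ → σ ≤ ρ
  ≤-ω     : ∀ {σ} → σ ≤ ω
  ∧-≤l    : ∀ {σ τ} → σ ∧ τ ≤ σ
  ∧-≤r    : ∀ {σ τ} → σ ∧ τ ≤ τ
  ≤-∨l    : ∀ {σ τ} → σ ≤ σ ∨ τ
  ≤-∨r    : ∀ {σ τ} → τ ≤ σ ∨ τ
  ≤-∧     : ∀ {σ τ ρ} → σ ≤ τ → σ ≤ ρ → σ ≤ τ ∧ ρ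
  ∨-≤     : ∀ {σ τ ρ} → σ ≤ τ → ρ ≤ τ → σ ∨ ρ ≤ τ
  ≤-atom  : ∀ {n σ} → atom n ≤ σ ⇒ atom n
  ≤-ω⇒    : ∀ {σ} → ω ≤ σ ⇒ ω
  ≤-⇒     : ∀ {σ σ' τ τ'} → σ' ≤ σ → τ ≤ τ' → σ ⇒ τ ≤ σ' ⇒ τ'

data Term : Set where
  var : ℕ → Term
  lam : Term → Term
  app : Term → Term → Term

shift : ℕ → ℕ → Term → Term
shift d c (var x)   = if x <ᵇ c then var x else var (x + d)
shift d c (lam M)   = lam (shift d (suc c) M)
shift d c (app M N) = app (shift d c M) (shift d c N)

-- substAt k N M : substitute N for variable k in M (capture-avoiding),
-- decrementing the variables above k
substAt : ℕ → Term → Term → Term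
substAt k N (var x) with compare x k
... | less _ _    = var x
... | equal _     = shift k 0 N
... | greater _ j = var (k + j)
substAt k N (lam M)   = lam (substAt (suc k) N M)
substAt k N (app M P) = app (substAt k N M) (substAt k N P)

-- M [ N ] : substitute N for the variable bound by the outermost
-- (removed) binder, i.e. index 0
_[_] : Term → Term → Term
M [ N ] = substAt 0 N M

infix 4 _→β_
data _→β_ : Term → Term → Set where
  β    : ∀ {M N} → app (lam M) N →β M [ N ]
  ξlam : ∀ {M M'} → M →β M' → lam M →β lam M'
  ξl   : ∀ {M M' N} → M →β M' → app M N →β app M' N
  ξr   : ∀ {M N N'} → N →β N' → app M N →β app M N'

infix 4 _=β_
data _=β_ : Term → Term → Set where
  =β-refl  : ∀ {M} → M =β M
  =β-step  : ∀ {M N} → M →β N → M =β N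
  =β-sym   : ∀ {M N} → M =β N → N =β M
  =β-trans : ∀ {M N P} → M =β N → N =β P → M =β P

lams : ℕ → Term → Term
lams zero    M = M
lams (suc n) M = lams n (lam M)

-- λ x y₁ … yₙ . x (Id₁ y₁) … (Idₙ yₙ)
-- Under the n+1 binders: x = var n, y_(i+1) = var (n ∸ suc i) for i : Fin n;
-- the Id's are shifted past the n+1 new binders.
fhiBody : (n : ℕ) → (Fin n → Term) → Term
fhiBody n ids =
  lams (suc n)
    (foldl app (var n)
      (List.tabulate (λ (i : Fin n) →
         app (shift (suc n) 0 (ids i)) (var (n ∸ suc (toℕ i))))))

data FHI : Term → Set where
  fhi : ∀ {M} (n : ℕ) (ids : Fin n → Term) →
        (∀ i → FHI (ids i)) → M =β fhiBody n ids → FHI M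

-- Environments: finite maps from variables (indices) to types, given as
-- functions ℕ → Maybe Ty (finiteness of support is automatic for
-- derivable judgements).

Env : Set
Env = ℕ → Maybe Ty

∅ : Env
∅ _ = nothing

_▸_ : Ty → Env → Env
(σ ▸ Γ) zero    = just σ
(σ ▸ Γ) (suc n) = Γ n

Singleton : Env → ℕ → Ty → Set
Singleton Γ x σ = (Γ x ≡ just σ) × (∀ y → y ≢ x → Γ y ≡ nothing)

-- Γ = Γ₁ , Γ₂  (union with disjoint domains)
Split : Env → Env → Env → Set
Split Γ Γ₁ Γ₂ = ∀ n → ((Γ n ≡ Γ₁ n) × (Γ₂ n ≡ nothing))
                    ⊎ ((Γ n ≡ Γ₂ n) × (Γ₁ n ≡ nothing))

infix 3 _⊢_∶_
data _⊢_∶_ : Env → Term → Ty → Set where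
  Ax  : ∀ {Γ x σ} → Singleton Γ x σ → Γ ⊢ var x ∶ σ
  Eq  : ∀ {Γ M σ τ} → Γ ⊢ M ∶ σ → σ ≃ τ → Γ ⊢ M ∶ τ
  ⇒I  : ∀ {Γ M σ τ} → (σ ▸ Γ) ⊢ M ∶ τ → Γ ⊢ lam M ∶ σ ⇒ τ
  ⇒E  : ∀ {Γ Γ₁ Γ₂ M N σ τ} → Split Γ Γ₁ Γ₂ →
        Γ₁ ⊢ M ∶ σ ⇒ τ → Γ₂ ⊢ N ∶ σ → Γ ⊢ app M N ∶ τ
  ∧I  : ∀ {Γ M σ τ} → Γ ⊢ M ∶ σ → Γ ⊢ M ∶ τ → Γ ⊢ M ∶ σ ∧ τ
  ∧El : ∀ {Γ M σ τ} → Γ ⊢ M ∶ σ ∧ τ → Γ ⊢ M ∶ σ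
  ∧Er : ∀ {Γ M σ τ} → Γ ⊢ M ∶ σ ∧ τ → Γ ⊢ M ∶ τ
  ∨Il : ∀ {Γ M σ τ} → Γ ⊢ M ∶ σ → Γ ⊢ M ∶ σ ∨ τ
  ∨Ir : ∀ {Γ M σ τ} → Γ ⊢ M ∶ σ → Γ ⊢ M ∶ τ ∨ σ
  ∨E  : ∀ {Γ Γ₁ Γ₂ M N σ τ ζ ρ} → Split Γ Γ₁ Γ₂ →
        ((σ ∧ ζ) ▸ Γ₁) ⊢ M ∶ ρ → ((τ ∧ ζ) ▸ Γ₁) ⊢ M ∶ ρ →
        Γ₂ ⊢ N ∶ (σ ∨ τ) ∧ ζ → Γ ⊢ M [ N ] ∶ ρ

infix 4 _≈s_
_≈s_ : Ty → Ty → Set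
σ ≈s τ = Σ Term λ Id → FHI Id × (∅ ⊢ Id ∶ σ ⇒ τ) × (∅ ⊢ Id ∶ τ ⇒ σ)

-- The preorder ≤ has a cut-free presentation ≤ᶜ (cut is admissible). The arrow rules of a
-- cut-free derivation of σ ≤ τ form a tree, and the hereditary η-expansion of a variable along
-- that tree is a finite hereditary identity of type σ → τ: arrow rules are matched by the
-- η-expansion, ∧/∨ rules by the typing rules for ∧ and ∨, and atoms and ω by the equivalences
-- φ ≃ ω → φ and ω ≃ ω → ω. Expanding along a larger tree preserves the typing, so one identity
-- along the join of two trees serves both directions of σ ≤ τ ≤ σ, giving σ ∧ τ ≈s σ and
-- σ ∨ τ ≈s τ.

module Submission where

open import Defs
open import Data.Bool using (true; false)
open import Data.Empty using (⊥-elim)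
open import Data.Fin using (Fin; toℕ; zero; suc)
open import Data.Maybe using (nothing)
open import Data.List using (List; foldl; tabulate)
open import Data.List.Properties using (tabulate-cong)
open import Data.Nat using (ℕ; zero; suc; pred; _+_; _∸_; _<ᵇ_; compare; less; equal; greater; z≤n; s≤s)
  renaming (_≤_ to _≤ℕ_; _<_ to _<ℕ_)
open import Data.Nat.Properties
  using (<ᵇ⇒<; <⇒<ᵇ; ≤⇒≯; <-irrefl; <-asym; <-cmp; <-≤-connex; <-≤-trans; m≤m+n; m<n⇒m<1+n; +-monoˡ-≤; +-assoc; +-comm; +-identityʳ)
  renaming (≤-trans to ≤ℕ-trans)
open import Data.Product using (Σ; _×_; _,_)
open import Data.Sum using (inj₁; inj₂)
open import Relation.Binary.Definitions using (tri<; tri≈; tri>)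
open import Relation.Binary.PropositionalEquality using (_≡_; refl; sym; trans; cong; cong₂; subst)

shift-var-< : ∀ d {c x} → x <ℕ c → shift d c (var x) ≡ var x
shift-var-< d {c} {x} x<c with x <ᵇ c | <⇒<ᵇ x<c
... | true | _ = refl

shift-var-≥ : ∀ d {c x} → c ≤ℕ x → shift d c (var x) ≡ var (x + d)
shift-var-≥ d {c} {x} c≤x with x <ᵇ c | <ᵇ⇒< x c
... | false | _   = refl
... | true  | x<c = ⊥-elim (≤⇒≯ c≤x (x<c _))

substAt-var-< : ∀ {k} N {x} → x <ℕ k → substAt k N (var x) ≡ var x
substAt-var-< {k} N {x} x<k with compare x k
... | less _ _    = refl
... | equal _     = ⊥-elim (<-irrefl refl x<k)
... | greater _ j = ⊥-elim (<-asym x<k (s≤s (m≤m+n k j)))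

substAt-var-≡ : ∀ {k} N {x} → x ≡ k → substAt k N (var x) ≡ shift k 0 N
substAt-var-≡ {k} N {x} x≡k with compare x k
... | less m j    = ⊥-elim (<-irrefl x≡k (s≤s (m≤m+n m j)))
... | equal _     = refl
... | greater _ j = ⊥-elim (<-irrefl (sym x≡k) (s≤s (m≤m+n k j)))

substAt-var-> : ∀ {k} N {x} → k <ℕ x → substAt k N (var x) ≡ var (pred x)
substAt-var-> {k} N {x} k<x with compare x k
... | less m j    = ⊥-elim (<-asym k<x (s≤s (m≤m+n m j)))
... | equal _     = ⊥-elim (<-irrefl refl k<x)
... | greater _ _ = refl

shift-zero : ∀ c M → shift 0 c M ≡ M
shift-zero c (var x) with x <ᵇ c
... | true  = refl
... | false = cong var (+-identityʳ x)
shift-zero c (lam M)   = cong lam (shift-zero (suc c) M)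
shift-zero c (app M N) = cong₂ app (shift-zero c M) (shift-zero c N)

shift-shift : ∀ a b {c c'} M → c ≤ℕ c' → c' ≤ℕ c + b →
              shift a c' (shift b c M) ≡ shift (b + a) c M
shift-shift a b {c} {c'} (var x) c≤c' c'≤c+b with <-≤-connex x c
... | inj₁ x<c rewrite shift-var-< b x<c | shift-var-< a (<-≤-trans x<c c≤c')
                     | shift-var-< (b + a) x<c = refl
... | inj₂ c≤x rewrite shift-var-≥ b c≤x
                     | shift-var-≥ a (≤ℕ-trans c'≤c+b (+-monoˡ-≤ b c≤x))
                     | shift-var-≥ (b + a) c≤x = cong var (+-assoc x b a)
shift-shift a b (lam M) c≤c' c'≤c+b = cong lam (shift-shift a b M (s≤s c≤c') (s≤s c'≤c+b))
shift-shift a b (app M N) c≤c' c'≤c+b =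
  cong₂ app (shift-shift a b M c≤c' c'≤c+b) (shift-shift a b N c≤c' c'≤c+b)

shift-var-pred : ∀ {c k x} → c ≤ℕ k → k <ℕ x → shift 1 c (var (pred x)) ≡ var x
shift-var-pred {x = suc x} c≤k (s≤s k≤x) =
  trans (shift-var-≥ 1 (≤ℕ-trans c≤k k≤x)) (cong var (+-comm x 1))

substAt-shift-var : ∀ {c k} → c ≤ℕ k → ∀ N x →
                    substAt (suc k) N (shift 1 c (var x)) ≡ shift 1 c (substAt k N (var x))
substAt-shift-var {c} {k} c≤k N x with <-≤-connex x c
... | inj₁ x<c rewrite substAt-var-< N (<-≤-trans x<c c≤k) | shift-var-< 1 x<c =
  substAt-var-< N (m<n⇒m<1+n (<-≤-trans x<c c≤k))
... | inj₂ c≤x with <-cmp x k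
...   | tri< x<k _ _ rewrite substAt-var-< N x<k | shift-var-≥ 1 c≤x | +-comm x 1 =
  substAt-var-< N (s≤s x<k)
...   | tri≈ _ x≡k _ rewrite substAt-var-≡ N x≡k | shift-var-≥ 1 c≤x | +-comm x 1 =
  trans (substAt-var-≡ N (cong suc x≡k))
        (sym (trans (shift-shift 1 k N z≤n c≤k) (cong (λ d → shift d 0 N) (+-comm k 1))))
...   | tri> _ _ k<x rewrite substAt-var-> N k<x | shift-var-≥ 1 c≤x | +-comm x 1 =
  trans (substAt-var-> N (s≤s k<x)) (sym (shift-var-pred c≤k k<x))

substAt-shift : ∀ {c k} → c ≤ℕ k → ∀ N M →
                substAt (suc k) N (shift 1 c M) ≡ shift 1 c (substAt k N M)
substAt-shift c≤k N (var x)   = substAt-shift-var c≤k N x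
substAt-shift c≤k N (lam M)   = cong lam (substAt-shift (s≤s c≤k) N M)
substAt-shift c≤k N (app M P) = cong₂ app (substAt-shift c≤k N M) (substAt-shift c≤k N P)

data Scoped : ℕ → Term → Set where
  var : ∀ {n x} → x <ℕ n → Scoped n (var x)
  lam : ∀ {n M} → Scoped (suc n) M → Scoped n (lam M)
  app : ∀ {n M N} → Scoped n M → Scoped n N → Scoped n (app M N)

Scoped-weaken : ∀ {m n M} → m ≤ℕ n → Scoped m M → Scoped n M
Scoped-weaken m≤n (var x<m)   = var (<-≤-trans x<m m≤n)
Scoped-weaken m≤n (lam M)     = lam (Scoped-weaken (s≤s m≤n) M)
Scoped-weaken m≤n (app M N)   = app (Scoped-weaken m≤n M) (Scoped-weaken m≤n N)

Scoped-shift : ∀ {n M} j → Scoped n M → Scoped (suc n) (shift 1 j M)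
Scoped-shift j (var {x = x} x<n) with <-≤-connex x j
... | inj₁ x<j rewrite shift-var-< 1 x<j = var (m<n⇒m<1+n x<n)
... | inj₂ j≤x rewrite shift-var-≥ 1 j≤x | +-comm x 1 = var (s≤s x<n)
Scoped-shift j (lam M)   = lam (Scoped-shift (suc j) M)
Scoped-shift j (app M N) = app (Scoped-shift j M) (Scoped-shift j N)

shift-Scoped : ∀ {n M} d {c} → n ≤ℕ c → Scoped n M → shift d c M ≡ M
shift-Scoped d n≤c (var x<n) = shift-var-< d (<-≤-trans x<n n≤c)
shift-Scoped d n≤c (lam M)   = cong lam (shift-Scoped d (s≤s n≤c) M)
shift-Scoped d n≤c (app M N) = cong₂ app (shift-Scoped d n≤c M) (shift-Scoped d n≤c N)

substAt-Scoped : ∀ {n M k} N → n ≤ℕ k → Scoped n M → substAt k N M ≡ M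
substAt-Scoped N n≤k (var x<n) = substAt-var-< N (<-≤-trans x<n n≤k)
substAt-Scoped N n≤k (lam M)   = cong lam (substAt-Scoped N (s≤s n≤k) M)
substAt-Scoped N n≤k (app M P) = cong₂ app (substAt-Scoped N n≤k M) (substAt-Scoped N n≤k P)

infixr 5 _∷_

-- A shape is the list of the shapes of the arguments that get η-expanded.
data Shape : Set where
  []  : Shape
  _∷_ : Shape → Shape → Shape

expand : Shape → Term → Term
hereditaryId : Shape → Term

expand []      M = M
expand (A ∷ t) M = lam (expand t (app (shift 1 0 M) (app (hereditaryId A) (var 0))))

hereditaryId t = lam (expand t (var 0))

Scoped-expand : ∀ t {n M} → Scoped n M → Scoped n (expand t M)
Scoped-hereditaryId : ∀ t → Scoped 0 (hereditaryId t)

Scoped-expand []      M = M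
Scoped-expand (A ∷ t) M =
  lam (Scoped-expand t (app (Scoped-shift 0 M)
                            (app (Scoped-weaken z≤n (Scoped-hereditaryId A)) (var (s≤s z≤n)))))

Scoped-hereditaryId t = lam (Scoped-expand t (var (s≤s z≤n)))

substAt-expand : ∀ t k N M → substAt k N (expand t M) ≡ expand t (substAt k N M)
substAt-expand []      k N M = refl
substAt-expand (A ∷ t) k N M =
  cong lam (trans (substAt-expand t (suc k) N _)
    (cong (expand t) (cong₂ app (substAt-shift z≤n N M)
      (cong (λ Id → app Id (var 0)) (substAt-Scoped N z≤n (Scoped-hereditaryId A))))))

expand-var-subst : ∀ t N → expand t (var 0) [ N ] ≡ expand t N
expand-var-subst t N = trans (substAt-expand t 0 N (var 0)) (cong (expand t) (shift-zero 0 N))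

arity : Shape → ℕ
arity []      = 0
arity (_ ∷ t) = suc (arity t)

argShape : (t : Shape) → Fin (arity t) → Shape
argShape (A ∷ t) zero    = A
argShape (A ∷ t) (suc i) = argShape t i

expandedArgs : Shape → List Term
expandedArgs t =
  tabulate (λ (i : Fin (arity t)) → app (hereditaryId (argShape t i)) (var (arity t ∸ suc (toℕ i))))

lam-lams : ∀ n M → lam (lams n M) ≡ lams (suc n) M
lam-lams zero    M = refl
lam-lams (suc n) M = lam-lams n (lam M)

expand-spine : ∀ t M → expand t M ≡ lams (arity t) (foldl app (shift (arity t) 0 M) (expandedArgs t))
expand-spine []      M = sym (shift-zero 0 M)
expand-spine (A ∷ t) M =
  trans (cong lam (expand-spine t _))
   (trans (cong (λ X → lam (lams (arity t) (foldl app X (expandedArgs t))))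
       (cong₂ app (shift-shift (arity t) 1 M z≤n z≤n)
          (cong (λ Id → app Id (var (arity t))) (shift-Scoped (arity t) z≤n (Scoped-hereditaryId A)))))
     (lam-lams (arity t) _))

hereditaryId-FHI : ∀ t → FHI (hereditaryId t)
argShape-FHI : ∀ t i → FHI (hereditaryId (argShape t i))

hereditaryId-FHI t = fhi (arity t) (λ i → hereditaryId (argShape t i)) (argShape-FHI t)
  (subst (hereditaryId t =β_) hereditaryId≡fhiBody =β-refl)
  where
  n = arity t
  hereditaryId≡fhiBody : hereditaryId t ≡ fhiBody n (λ i → hereditaryId (argShape t i))
  hereditaryId≡fhiBody = trans (cong lam (expand-spine t (var 0)))
    (trans (lam-lams n _)
      (cong (λ L → lams (suc n) (foldl app (var n) L))
        (tabulate-cong (λ i → cong (λ Id → app Id (var (n ∸ suc (toℕ i))))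
           (sym (shift-Scoped (suc n) z≤n (Scoped-hereditaryId (argShape t i))))))))

argShape-FHI (A ∷ t) zero    = hereditaryId-FHI A
argShape-FHI (A ∷ t) (suc i) = argShape-FHI t i

infix 4 _≤ᶜ_

data _≤ᶜ_ : Ty → Ty → Set where
  ωR     : ∀ {σ} → σ ≤ᶜ ω
  ∧R     : ∀ {σ τ ρ} → σ ≤ᶜ τ → σ ≤ᶜ ρ → σ ≤ᶜ τ ∧ ρ
  ∨R₁    : ∀ {σ τ ρ} → σ ≤ᶜ τ → σ ≤ᶜ τ ∨ ρ
  ∨R₂    : ∀ {σ τ ρ} → σ ≤ᶜ ρ → σ ≤ᶜ τ ∨ ρ
  ∧L₁    : ∀ {σ ρ τ} → σ ≤ᶜ τ → σ ∧ ρ ≤ᶜ τ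
  ∧L₂    : ∀ {σ ρ τ} → ρ ≤ᶜ τ → σ ∧ ρ ≤ᶜ τ
  ∨L     : ∀ {σ ρ τ} → σ ≤ᶜ τ → ρ ≤ᶜ τ → σ ∨ ρ ≤ᶜ τ
  atom   : ∀ {n} → atom n ≤ᶜ atom n
  atom-⇒ : ∀ {n σ τ} → atom n ≤ᶜ τ → atom n ≤ᶜ σ ⇒ τ
  ω-⇒    : ∀ {ρ σ τ} → ω ≤ᶜ τ → ρ ≤ᶜ σ ⇒ τ
  ⇒-mono : ∀ {σ σ' τ τ'} → σ' ≤ᶜ σ → τ ≤ᶜ τ' → σ ⇒ τ ≤ᶜ σ' ⇒ τ'

≤ᶜ-refl : ∀ σ → σ ≤ᶜ σ
≤ᶜ-refl (atom n) = atom
≤ᶜ-refl ω        = ωR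
≤ᶜ-refl (σ ⇒ τ)  = ⇒-mono (≤ᶜ-refl σ) (≤ᶜ-refl τ)
≤ᶜ-refl (σ ∧ τ)  = ∧R (∧L₁ (≤ᶜ-refl σ)) (∧L₂ (≤ᶜ-refl τ))
≤ᶜ-refl (σ ∨ τ)  = ∨L (∨R₁ (≤ᶜ-refl σ)) (∨R₂ (≤ᶜ-refl τ))

≤ᶜ-trans : ∀ {σ τ ρ} → σ ≤ᶜ τ → τ ≤ᶜ ρ → σ ≤ᶜ ρ
≤ᶜ-trans d             ωR            = ωR
≤ᶜ-trans d             (∧R e e')     = ∧R (≤ᶜ-trans d e) (≤ᶜ-trans d e')
≤ᶜ-trans d             (∨R₁ e)       = ∨R₁ (≤ᶜ-trans d e)
≤ᶜ-trans d             (∨R₂ e)       = ∨R₂ (≤ᶜ-trans d e)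
≤ᶜ-trans d             (ω-⇒ e)       = ω-⇒ e
≤ᶜ-trans (∧L₁ d)       e             = ∧L₁ (≤ᶜ-trans d e)
≤ᶜ-trans (∧L₂ d)       e             = ∧L₂ (≤ᶜ-trans d e)
≤ᶜ-trans (∨L d d')     e             = ∨L (≤ᶜ-trans d e) (≤ᶜ-trans d' e)
≤ᶜ-trans (∧R d d')     (∧L₁ e)       = ≤ᶜ-trans d e
≤ᶜ-trans (∧R d d')     (∧L₂ e)       = ≤ᶜ-trans d' e
≤ᶜ-trans (∨R₁ d)       (∨L e e')     = ≤ᶜ-trans d e
≤ᶜ-trans (∨R₂ d)       (∨L e e')     = ≤ᶜ-trans d e'
≤ᶜ-trans atom          e             = e
≤ᶜ-trans (atom-⇒ d)    (⇒-mono e e') = atom-⇒ (≤ᶜ-trans d e')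
≤ᶜ-trans (ω-⇒ d)       (⇒-mono e e') = ω-⇒ (≤ᶜ-trans d e')
≤ᶜ-trans (⇒-mono d d') (⇒-mono e e') = ⇒-mono (≤ᶜ-trans e d) (≤ᶜ-trans d' e')

≤⇒≤ᶜ : ∀ {σ τ} → σ ≤ τ → σ ≤ᶜ τ
≤⇒≤ᶜ {σ} ≤-refl    = ≤ᶜ-refl σ
≤⇒≤ᶜ (≤-trans p q) = ≤ᶜ-trans (≤⇒≤ᶜ p) (≤⇒≤ᶜ q)
≤⇒≤ᶜ ≤-ω           = ωR
≤⇒≤ᶜ {σ ∧ _} ∧-≤l  = ∧L₁ (≤ᶜ-refl σ)
≤⇒≤ᶜ {_ ∧ τ} ∧-≤r  = ∧L₂ (≤ᶜ-refl τ)
≤⇒≤ᶜ {σ} ≤-∨l      = ∨R₁ (≤ᶜ-refl σ)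
≤⇒≤ᶜ {σ} ≤-∨r      = ∨R₂ (≤ᶜ-refl σ)
≤⇒≤ᶜ (≤-∧ p q)     = ∧R (≤⇒≤ᶜ p) (≤⇒≤ᶜ q)
≤⇒≤ᶜ (∨-≤ p q)     = ∨L (≤⇒≤ᶜ p) (≤⇒≤ᶜ q)
≤⇒≤ᶜ ≤-atom        = atom-⇒ atom
≤⇒≤ᶜ ≤-ω⇒          = ω-⇒ ωR
≤⇒≤ᶜ (≤-⇒ p q)     = ⇒-mono (≤⇒≤ᶜ p) (≤⇒≤ᶜ q)

infix 4 _⊑_
infixr 6 _⊔_

data _⊑_ : Shape → Shape → Set where
  []  : ∀ {t} → [] ⊑ t
  _∷_ : ∀ {A A' t t'} → A ⊑ A' → t ⊑ t' → A ∷ t ⊑ A' ∷ t'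

⊑-refl : ∀ t → t ⊑ t
⊑-refl []      = []
⊑-refl (A ∷ t) = ⊑-refl A ∷ ⊑-refl t

⊑-trans : ∀ {s t u} → s ⊑ t → t ⊑ u → s ⊑ u
⊑-trans []      _       = []
⊑-trans (p ∷ q) (r ∷ s) = ⊑-trans p r ∷ ⊑-trans q s

_⊔_ : Shape → Shape → Shape
[]      ⊔ u       = u
(A ∷ t) ⊔ []      = A ∷ t
(A ∷ t) ⊔ (B ∷ u) = (A ⊔ B) ∷ (t ⊔ u)

⊔-upperˡ : ∀ t u → t ⊑ t ⊔ u
⊔-upperˡ []      u       = []
⊔-upperˡ (A ∷ t) []      = ⊑-refl (A ∷ t)
⊔-upperˡ (A ∷ t) (B ∷ u) = ⊔-upperˡ A B ∷ ⊔-upperˡ t u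

⊔-upperʳ : ∀ t u → u ⊑ t ⊔ u
⊔-upperʳ []      u       = ⊑-refl u
⊔-upperʳ (A ∷ t) []      = []
⊔-upperʳ (A ∷ t) (B ∷ u) = ⊔-upperʳ A B ∷ ⊔-upperʳ t u

⊔-⊑ˡ : ∀ {t u v} → t ⊔ u ⊑ v → t ⊑ v
⊔-⊑ˡ {t} {u} = ⊑-trans (⊔-upperˡ t u)

⊔-⊑ʳ : ∀ {t u v} → t ⊔ u ⊑ v → u ⊑ v
⊔-⊑ʳ {t} {u} = ⊑-trans (⊔-upperʳ t u)

-- The arrow skeleton of a cut-free derivation: every arrow rule contributes one η-expanded argument.
shape : ∀ {σ τ} → σ ≤ᶜ τ → Shape
shape ωR         = []
shape (∧R d e)   = shape d ⊔ shape e
shape (∨R₁ d)    = shape d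
shape (∨R₂ d)    = shape d
shape (∧L₁ d)    = shape d
shape (∧L₂ d)    = shape d
shape (∨L d e)   = shape d ⊔ shape e
shape atom       = []
shape (atom-⇒ d) = [] ∷ shape d
shape (ω-⇒ d)    = [] ∷ shape d
shape (⇒-mono d e) = shape d ∷ shape e

only₁ : Ty → Env
only₁ σ zero    = nothing
only₁ σ (suc n) = (σ ▸ ∅) n

⊢var₀ : ∀ {σ} → (σ ▸ ∅) ⊢ var 0 ∶ σ
⊢var₀ = Ax (refl , λ { zero 0≢0 → ⊥-elim (0≢0 refl) ; (suc _) _ → refl })

⊢var₁ : ∀ {σ} → only₁ σ ⊢ var 1 ∶ σ
⊢var₁ = Ax (refl , λ { zero _ → refl ; (suc zero) 1≢1 → ⊥-elim (1≢1 refl) ; (suc (suc _)) _ → refl })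

∅-split : ∀ Γ → Split Γ ∅ Γ
∅-split Γ _ = inj₂ (refl , refl)

only₁-split : ∀ σ τ → Split (τ ▸ (σ ▸ ∅)) (only₁ σ) (τ ▸ ∅)
only₁-split σ τ zero    = inj₂ (refl , refl)
only₁-split σ τ (suc _) = inj₁ (refl , refl)

⊢ω : ∀ {Γ M σ} → Γ ⊢ M ∶ σ → Γ ⊢ M ∶ ω
⊢ω p = ∧Er (Eq p ax-∧r)

-- (∨E) with two identical branches acts as a cut rule; the ω conjunct fills its context ζ.
⊢-subst : ∀ {σ Γ M N ρ} → ((σ ∧ ω) ▸ ∅) ⊢ M ∶ ρ → Γ ⊢ N ∶ σ → Γ ⊢ M [ N ] ∶ ρ
⊢-subst {σ} p q = ∨E {σ = σ} {τ = σ} {ζ = ω} (∅-split _) p p (Eq (∨Il q) ax-∧r)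

⊢expand : ∀ t {σ Γ M ρ} → ((σ ∧ ω) ▸ ∅) ⊢ expand t (var 0) ∶ ρ → Γ ⊢ M ∶ σ → Γ ⊢ expand t M ∶ ρ
⊢expand t {Γ = Γ} {M} p q = subst (λ X → Γ ⊢ X ∶ _) (expand-var-subst t M) (⊢-subst p q)

⊢expand-∷ : ∀ A t {σ α β τ₁ τ₂ Γ M} →
            (∀ {Δ X} → Δ ⊢ X ∶ σ → Δ ⊢ X ∶ α ⇒ β) →
            ∅ ⊢ hereditaryId A ∶ τ₁ ⇒ α →
            (∀ {Δ X} → Δ ⊢ X ∶ β → Δ ⊢ expand t X ∶ τ₂) →
            Γ ⊢ M ∶ σ → Γ ⊢ expand (A ∷ t) M ∶ τ₁ ⇒ τ₂
⊢expand-∷ A t toArrow ⊢Id ⊢expand-t =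
  ⊢expand (A ∷ t)
    (⇒I (⊢expand-t (⇒E (only₁-split _ _) (toArrow (∧El ⊢var₁)) (⇒E (∅-split _) ⊢Id ⊢var₀))))

expand-ω : ∀ t {Γ M} → Γ ⊢ M ∶ ω → Γ ⊢ expand t M ∶ ω
⊢hereditaryId-ω : ∀ A {σ} → ∅ ⊢ hereditaryId A ∶ σ ⇒ ω

expand-ω []      p = p
expand-ω (A ∷ t) p =
  Eq (⊢expand-∷ A t (λ q → Eq q ax-ω) (⊢hereditaryId-ω A) (expand-ω t) p) (≃-sym ax-ω)

⊢hereditaryId-ω A = ⇒I (expand-ω A (⊢ω ⊢var₀))

expand-atom : ∀ t {n Γ M} → Γ ⊢ M ∶ atom n → Γ ⊢ expand t M ∶ atom n
expand-atom []      p = p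
expand-atom (A ∷ t) p =
  Eq (⊢expand-∷ A t (λ q → Eq q ax-atom) (⊢hereditaryId-ω A) (expand-atom t) p) (≃-sym ax-atom)

⊢expand-shape : ∀ {σ τ} (d : σ ≤ᶜ τ) {t Γ M} → shape d ⊑ t → Γ ⊢ M ∶ σ → Γ ⊢ expand t M ∶ τ
⊢expand-shape ωR         {t} _ p = expand-ω t (⊢ω p)
⊢expand-shape (∧R d e)   h p = ∧I (⊢expand-shape d (⊔-⊑ˡ h) p) (⊢expand-shape e (⊔-⊑ʳ h) p)
⊢expand-shape (∨R₁ d)    h p = ∨Il (⊢expand-shape d h p)
⊢expand-shape (∨R₂ d)    h p = ∨Ir (⊢expand-shape d h p)
⊢expand-shape (∧L₁ d)    h p = ⊢expand-shape d h (∧El p)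
⊢expand-shape (∧L₂ d)    h p = ⊢expand-shape d h (∧Er p)
⊢expand-shape (∨L d e)   {t} {Γ} {M} h p =
  subst (λ X → Γ ⊢ X ∶ _) (expand-var-subst t M)
    (∨E {ζ = ω} (∅-split _) (⊢expand-shape d (⊔-⊑ˡ h) (∧El ⊢var₀))
                            (⊢expand-shape e (⊔-⊑ʳ h) (∧El ⊢var₀)) (Eq p ax-∧r))
⊢expand-shape atom       {t} _ p = expand-atom t p
⊢expand-shape (atom-⇒ d) {A ∷ t} (_ ∷ h) p =
  ⊢expand-∷ A t (λ q → Eq q ax-atom) (⊢hereditaryId-ω A) (⊢expand-shape d h) p
⊢expand-shape (ω-⇒ d)    {A ∷ t} (_ ∷ h) p =
  ⊢expand-∷ A t (λ q → Eq (⊢ω q) ax-ω) (⊢hereditaryId-ω A) (⊢expand-shape d h) p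
⊢expand-shape (⇒-mono d e) {A ∷ t} (g ∷ h) p =
  ⊢expand-∷ A t (λ q → q) (⇒I (⊢expand-shape d g ⊢var₀)) (⊢expand-shape e h) p

⊢hereditaryId : ∀ {σ τ} (d : σ ≤ᶜ τ) {t} → shape d ⊑ t → ∅ ⊢ hereditaryId t ∶ σ ⇒ τ
⊢hereditaryId d h = ⇒I (⊢expand-shape d h ⊢var₀)

≤⇒FHI : ∀ {σ τ} → σ ≤ τ → Σ Term λ Id → FHI Id × (∅ ⊢ Id ∶ σ ⇒ τ)
≤⇒FHI p = hereditaryId (shape d) , hereditaryId-FHI (shape d) , ⊢hereditaryId d (⊑-refl (shape d))
  where d = ≤⇒≤ᶜ p

≤-antisym⇒≈s : ∀ {σ τ} → σ ≤ τ → τ ≤ σ → σ ≈s τ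
≤-antisym⇒≈s p q =
  hereditaryId t , hereditaryId-FHI t ,
  ⊢hereditaryId d (⊔-upperˡ (shape d) (shape e)) , ⊢hereditaryId e (⊔-upperʳ (shape d) (shape e))
  where
  d = ≤⇒≤ᶜ p
  e = ≤⇒≤ᶜ q
  t = shape d ⊔ shape e

lemma3p8 : (σ τ : Ty) → σ ≤ τ →
    (Σ Term λ Id → FHI Id × (∅ ⊢ Id ∶ σ ⇒ τ)) × (σ ∧ τ ≈s σ) × (σ ∨ τ ≈s τ)
lemma3p8 σ τ σ≤τ =
  ≤⇒FHI σ≤τ ,
  ≤-antisym⇒≈s ∧-≤l (≤-∧ ≤-refl σ≤τ) ,
  ≤-antisym⇒≈s (∨-≤ σ≤τ ≤-refl) ≤-∨r
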